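{- Let $G=(V,E)$ be a strongly biconnected directed graph and let $G_s=(V,E_s)$ with $E_s\subseteq E$ be a subgraph of $G$ such that $G_s$ is strongly connected and $G_s$ has $t>0$ strongly biconnected components. Let $(u,w)\in E\setminus E_s$ be an edge such that $u$ and $w$ are not in the same strongly biconnected component of $G_s$. Then the directed graph $(V,E_s\cup\{(u,w)\})$ contains at most $t-1$ strongly biconnected components.
   Context: A directed graph is strongly biconnected if it is strongly connected and its underlying undirected graph is biconnected. A strongly biconnected component of a directed graph is a maximal strongly biconnected subgraph of it. -}

module Defs where

open import Data.Nat using (ℕ)
open import Data.Fin using (Fin)
open import Data.Fin.Subset using (Subset; _∈_; _∉_; _⊆_; ⊤; _∪_; ⁅_⁆; Nonempty)
open import Data.Vec using (Vec; lookup; _[_]%=_)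
open import Data.List using (List; length)
open import Data.List.Relation.Unary.Unique.Propositional using (Unique)
import Data.List.Membership.Propositional as LM
open import Data.Product using (Σ; ∃; _×_)
open import Data.Sum using (_⊎_)
open import Relation.Nullary using (¬_)
open import Relation.Binary.PropositionalEquality using (_≡_; _≢_)
open import Function.Bundles using (_⇔_)

-- Edge sets of directed graphs on vertex set Fin n: adjacency rows.
-- (x , y) is an edge iff y ∈ lookup F x.
EdgeSet : ℕ → Set
EdgeSet n = Vec (Subset n) n

module _ {n : ℕ} where

  _⇒_∈ₑ_ : Fin n → Fin n → EdgeSet n → Set
  x ⇒ y ∈ₑ F = y ∈ lookup F x

  _⊆ₑ_ : EdgeSet n → EdgeSet n → Set
  F ⊆ₑ F' = ∀ {x y} → x ⇒ y ∈ₑ F → x ⇒ y ∈ₑ F'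

  addEdge : EdgeSet n → Fin n → Fin n → EdgeSet n
  addEdge F u w = F [ u ]%= (λ row → row ∪ ⁅ w ⁆)

  record Graph : Set where
    constructor mkGraph
    field
      verts : Subset n
      edges : EdgeSet n
  open Graph public

  spanning : EdgeSet n → Graph
  spanning F = mkGraph ⊤ F

  IsSubgraph : Graph → Graph → Set
  IsSubgraph H G =
    (verts H ⊆ verts G) × (edges H ⊆ₑ edges G) ×
    (∀ {x y} → x ⇒ y ∈ₑ edges H → (x ∈ verts H) × (y ∈ verts H))

  data Walk (H : Graph) : Fin n → Fin n → Set where
    here : ∀ {x} → x ∈ verts H → Walk H x x
    step : ∀ {x y z} → x ∈ verts H → x ⇒ y ∈ₑ edges H → Walk H y z → Walk H x z

  StronglyConnected : Graph → Set
  StronglyConnected H = ∀ x y → x ∈ verts H → y ∈ verts H → Walk H x y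

  data UWalk (H : Graph) (P : Fin n → Set) : Fin n → Fin n → Set where
    here : ∀ {x} → P x → UWalk H P x x
    step : ∀ {x y z} → P x → (x ⇒ y ∈ₑ edges H ⊎ y ⇒ x ∈ₑ edges H) →
           UWalk H P y z → UWalk H P x z

  Connected : Graph → Set
  Connected H = ∀ x y → x ∈ verts H → y ∈ verts H → UWalk H (_∈ verts H) x y

  ArticulationPoint : Graph → Fin n → Set
  ArticulationPoint H v = v ∈ verts H × ∃ λ x → ∃ λ y →
    x ∈ verts H × y ∈ verts H × x ≢ v × y ≢ v ×
    ¬ UWalk H (λ z → z ∈ verts H × z ≢ v) x y

  Biconnected : Graph → Set
  Biconnected H = Nonempty (verts H) × Connected H × (∀ v → ¬ ArticulationPoint H v)

  StronglyBiconnected : Graph → Set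
  StronglyBiconnected H = StronglyConnected H × Biconnected H

  IsSBC : Graph → Graph → Set
  IsSBC G H = IsSubgraph H G × StronglyBiconnected H ×
    (∀ H' → IsSubgraph H' G → StronglyBiconnected H' → IsSubgraph H H' → H' ≡ H)

  NumSBC : Graph → ℕ → Set
  NumSBC G t = Σ (List Graph) λ L →
    Unique L × (∀ H → (H LM.∈ L) ⇔ IsSBC G H) × length L ≡ t

module Submission where

-- Since Gs is strongly connected there is a simple path w → … → q → u in Gs;
-- together with the new edge u → w it forms a cycle Z of the new graph Gs'.  Its first
-- edge w → x₁ and its last edge q → u each close a cycle of Gs, so they lie in SBCs C₁
-- and C₂ of Gs, and C₁ ≠ C₂ because u and w share no SBC of Gs.  Neither C₁ nor C₂ is an
-- SBC of Gs': the union of Cᵢ with Z is strongly biconnected and contains the new edge.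
-- Every SBC of Gs' either avoids {u , w}, and is then an SBC of Gs, or is the unique SBC
-- of Gs' through u and w.  Counting gives |SBC(Gs')| + 2 ≤ |SBC(Gs)| + 1.

open import Defs
open import Level using (0ℓ)
open import Data.Nat using (ℕ; zero; suc; _+_; _*_; _≤_; _<_; _∸_; z≤n; s≤s⁻¹)
import Data.Nat.Properties as ℕ
open import Data.Fin using (Fin)
import Data.Fin.Properties as Fin
open import Data.Fin.Subset
  using (Subset; _∈_; _⊆_; ⊤; _∪_; _∩_; ⁅_⁆; ∣_∣; inside; outside)
  renaming (⊥ to ∅)
open import Data.Fin.Subset.Properties
open import Data.Vec using (Vec; lookup; tabulate; zipWith; _∷_; [])
import Data.Vec.Properties as Vec
open import Data.List using (List; length; _∷_; []) renaming (lookup to lookupₗ)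
import Data.List.Relation.Unary.Any as Any
open import Data.List.Relation.Unary.Any using (here; there; any?)
open import Data.List.Relation.Unary.Any.Properties using (lookup-index)
open import Data.List.Relation.Unary.All.Properties.Core using (¬Any⇒All¬)
open import Data.List.Relation.Unary.All using ([]; _∷_)
open import Data.List.Relation.Unary.AllPairs using ([]; _∷_)
open import Data.List.Relation.Unary.Unique.Propositional using (Unique)
open import Data.List.Relation.Unary.Unique.Propositional.Properties using (Unique[x∷xs]⇒x∉xs)
open import Data.List.Membership.Propositional using (find; lose)
  renaming (_∈_ to _∈ₗ_; _∉_ to _∉ₗ_)
open import Data.List.Membership.Propositional.Properties using (∈-lookup)
open import Data.Product using (Σ; ∃; _×_; _,_; proj₁; proj₂)
open import Data.Sum using (_⊎_; inj₁; inj₂; [_,_]′; swap)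
open import Data.Empty using (⊥-elim)
open import Effect.Monad using (RawMonad)
open import Relation.Nullary using (¬_; yes; no)
open import Relation.Nullary.Decidable using (_×-dec_; decidable-stable; ¬¬-excluded-middle)
open import Relation.Nullary.Negation using (¬¬-Monad)
open import Relation.Binary.PropositionalEquality
  using (_≡_; _≢_; refl; sym; trans; cong; cong₂; subst; module ≡-Reasoning)
open import Function.Base using (_∘_)
open import Function.Bundles using (_⇔_; Equivalence)

-- Classical steps (choosing maximal subgraphs) are carried out in the ¬¬-monad.
open RawMonad (¬¬-Monad {0ℓ}) using (pure; _>>=_)

unique-head : ∀ {A : Set} {x z : A} {ys} → Unique (x ∷ ys) → z ∈ₗ ys → x ≢ z
unique-head uniq z∈ x≡z = Unique[x∷xs]⇒x∉xs uniq (subst (_∈ₗ _) (sym x≡z) z∈)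

lookup-injective : ∀ {A : Set} {xs : List A} → Unique xs →
                   ∀ {i j} → lookupₗ xs i ≡ lookupₗ xs j → i ≡ j
lookup-injective {xs = x ∷ xs} _ {Fin.zero} {Fin.zero} _ = refl
lookup-injective {xs = x ∷ xs} u {Fin.zero} {Fin.suc j} eq = ⊥-elim (unique-head u (∈-lookup j) eq)
lookup-injective {xs = x ∷ xs} u {Fin.suc i} {Fin.zero} eq = ⊥-elim (unique-head u (∈-lookup i) (sym eq))
lookup-injective (_ ∷ u) {Fin.suc i} {Fin.suc j} eq = cong Fin.suc (lookup-injective u eq)

unique⊆⇒length≤ : ∀ {A : Set} {xs ys : List A} → Unique xs →
                  (∀ {x} → x ∈ₗ xs → x ∈ₗ ys) → length xs ≤ length ys
unique⊆⇒length≤ {xs = xs} {ys} uniq sub = Fin.injective⇒≤ position-injective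
  where
    open ≡-Reasoning
    position : Fin (length xs) → Fin (length ys)
    position i = Any.index (sub (∈-lookup i))
    position-injective : ∀ {i j} → position i ≡ position j → i ≡ j
    position-injective {i} {j} eq = lookup-injective uniq (begin
      lookupₗ xs i            ≡⟨ lookup-index (sub (∈-lookup i)) ⟩
      lookupₗ ys (position i) ≡⟨ cong (lookupₗ ys) eq ⟩
      lookupₗ ys (position j) ≡⟨ sym (lookup-index (sub (∈-lookup j))) ⟩
      lookupₗ xs j            ∎)

module _ {n : ℕ} where
  open import Data.List.Membership.DecPropositional (Fin._≟_ {n}) using () renaming (_∈?_ to _∈ₗ?_)

  _++ʷ_ : ∀ {H : Graph {n}} {x y z} → Walk H x y → Walk H y z → Walk H x z
  here _ ++ʷ q = q
  step x∈ e p ++ʷ q = step x∈ e (p ++ʷ q)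

  mapʷ : ∀ {H H' : Graph {n}} {x y} → verts H ⊆ verts H' → edges H ⊆ₑ edges H' →
         Walk H x y → Walk H' x y
  mapʷ vs es (here x∈) = here (vs x∈)
  mapʷ vs es (step x∈ e p) = step (vs x∈) (es e) (mapʷ vs es p)

  _++ᵘ_ : ∀ {H : Graph {n}} {P x y z} → UWalk H P x y → UWalk H P y z → UWalk H P x z
  here _ ++ᵘ q = q
  step px e p ++ᵘ q = step px e (p ++ᵘ q)

  start : ∀ {H : Graph {n}} {P x y} → UWalk H P x y → P x
  start (here px) = px
  start (step px _ _) = px

  end : ∀ {H : Graph {n}} {P x y} → UWalk H P x y → P y
  end (here py) = py
  end (step _ _ p) = end p

  reverseᵘ : ∀ {H : Graph {n}} {P x y} → UWalk H P x y → UWalk H P y x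
  reverseᵘ (here px) = here px
  reverseᵘ (step px e p) = reverseᵘ p ++ᵘ step (start p) (swap e) (here px)

  mapᵘ : ∀ {H H' : Graph {n}} {P Q : Fin n → Set} {x y} → (∀ {z} → P z → Q z) →
         edges H ⊆ₑ edges H' → UWalk H P x y → UWalk H' Q x y
  mapᵘ f es (here px) = here (f px)
  mapᵘ f es (step px (inj₁ e) p) = step (f px) (inj₁ (es e)) (mapᵘ f es p)
  mapᵘ f es (step px (inj₂ e) p) = step (f px) (inj₂ (es e)) (mapᵘ f es p)

  walk⇒uwalk : ∀ {H : Graph {n}} {x y} → Walk H x y → UWalk H (_∈ verts H) x y
  walk⇒uwalk (here x∈) = here x∈
  walk⇒uwalk (step x∈ e p) = step x∈ (inj₁ e) (walk⇒uwalk p)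

  strong⇒connected : ∀ {H : Graph {n}} → StronglyConnected H → Connected H
  strong⇒connected sc x y x∈ y∈ = walk⇒uwalk (sc x y x∈ y∈)

  avoidVertex : ∀ {H : Graph {n}} → StronglyBiconnected H → ∀ v {x y} →
                x ∈ verts H → y ∈ verts H → x ≢ v → y ≢ v →
                ¬ ¬ UWalk H (λ z → z ∈ verts H × z ≢ v) x y
  avoidVertex {H} (_ , _ , conn , noAP) v {x} {y} x∈ y∈ x≢v y≢v with v ∈? verts H
  ... | yes v∈ = λ noWalk → noAP v (v∈ , x , y , x∈ , y∈ , x≢v , y≢v , noWalk)
  ... | no v∉ = pure (mapᵘ (λ z∈ → z∈ , λ z≡v → v∉ (subst (_∈ verts H) z≡v z∈)) (λ e → e)
                           (conn x y x∈ y∈))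

  EdgesInside : Graph {n} → Set
  EdgesInside A = ∀ {x y} → x ⇒ y ∈ₑ edges A → (x ∈ verts A) × (y ∈ verts A)

  subgraph-refl : ∀ {A : Graph {n}} → EdgesInside A → IsSubgraph A A
  subgraph-refl ends = (λ x∈ → x∈) , (λ e → e) , ends

  subgraph-trans : ∀ {A B C : Graph {n}} → IsSubgraph A B → IsSubgraph B C → IsSubgraph A C
  subgraph-trans (vAB , eAB , inA) (vBC , eBC , _) = (λ x∈ → vBC (vAB x∈)) , (λ e → eBC (eAB e)) , inA

  addEdge⁻ : ∀ (F : EdgeSet n) u w {x y} → x ⇒ y ∈ₑ addEdge F u w →
             (x ⇒ y ∈ₑ F) ⊎ (x ≡ u × y ≡ w)
  addEdge⁻ F u w {x} {y} e with x Fin.≟ u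
  ... | no x≢u = inj₁ (subst (y ∈_) (Vec.lookup∘updateAt′ x u x≢u F) e)
  ... | yes refl with x∈p∪q⁻ (lookup F x) ⁅ w ⁆ (subst (y ∈_) (Vec.lookup∘updateAt x F) e)
  ...   | inj₁ old = inj₁ old
  ...   | inj₂ new = inj₂ (refl , x∈⁅y⁆⇒x≡y w new)

  addEdge⁺ : ∀ (F : EdgeSet n) u w → F ⊆ₑ addEdge F u w
  addEdge⁺ F u w {x} {y} e with x Fin.≟ u
  ... | yes refl = subst (y ∈_) (sym (Vec.lookup∘updateAt x F)) (x∈p∪q⁺ (inj₁ e))
  ... | no x≢u = subst (y ∈_) (sym (Vec.lookup∘updateAt′ x u x≢u F)) e

  addEdge-new : ∀ (F : EdgeSet n) u w → u ⇒ w ∈ₑ addEdge F u w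
  addEdge-new F u w = subst (w ∈_) (sym (Vec.lookup∘updateAt u F)) (x∈p∪q⁺ (inj₂ (x∈⁅x⁆ w)))

  -- Paths in an edge set, indexed by their list of vertices; "simple" = Unique list.

  data Path (F : EdgeSet n) : Fin n → Fin n → List (Fin n) → Set where
    [_] : ∀ a → Path F a a (a ∷ [])
    _∷_ : ∀ {a b c xs} → a ⇒ b ∈ₑ F → Path F b c xs → Path F a c (a ∷ xs)

  mapᵖ : ∀ {F F' a c xs} → F ⊆ₑ F' → Path F a c xs → Path F' a c xs
  mapᵖ sub [ a ] = [ a ]
  mapᵖ sub (e ∷ p) = sub e ∷ mapᵖ sub p

  first∈ : ∀ {F a c xs} → Path F a c xs → a ∈ₗ xs
  first∈ [ a ] = here refl
  first∈ (e ∷ p) = here refl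

  last∈ : ∀ {F a c xs} → Path F a c xs → c ∈ₗ xs
  last∈ [ a ] = here refl
  last∈ (e ∷ p) = there (last∈ p)

  suffixFrom : ∀ {F b c ys a} → Path F b c ys → Unique ys → a ∈ₗ ys →
               Σ (List (Fin n)) λ zs → Path F a c zs × Unique zs
  suffixFrom [ b ] uniq (here refl) = _ , [ b ] , uniq
  suffixFrom (e ∷ p) uniq (here refl) = _ , e ∷ p , uniq
  suffixFrom [ b ] _ (there ())
  suffixFrom (e ∷ p) (_ ∷ uniq) (there a∈) = suffixFrom p uniq a∈

  -- Every walk can be shortened to a simple path (cut at the last repeated vertex).
  simplePath : ∀ {F a c} → Walk (spanning F) a c →
               Σ (List (Fin n)) λ xs → Path F a c xs × Unique xs
  simplePath (here {a} _) = _ , [ a ] , ([] ∷ [])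
  simplePath (step {x} _ e walk) with simplePath walk
  ... | ys , p , uniq with x ∈ₗ? ys
  ...   | yes x∈ys = suffixFrom p uniq x∈ys
  ...   | no x∉ys = x ∷ ys , e ∷ p , (¬Any⇒All¬ ys x∉ys ∷ uniq)

  lastEdge : ∀ {F a c xs} → Path F a c xs → Unique xs → a ≢ c →
             Σ (Fin n) λ q → q ∈ₗ xs × q ⇒ c ∈ₑ F × q ≢ c
  lastEdge [ a ] _ a≢c = ⊥-elim (a≢c refl)
  lastEdge (e ∷ [ c ]) _ a≢c = _ , here refl , e , a≢c
  lastEdge (e ∷ p@(_ ∷ p')) (_ ∷ uniq) _
    with lastEdge p uniq (unique-head uniq (last∈ p'))
  ... | q , q∈ , q⇒c , q≢c = q , there q∈ , q⇒c , q≢c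

  vertexSet : List (Fin n) → Subset n
  vertexSet [] = ∅
  vertexSet (x ∷ xs) = ⁅ x ⁆ ∪ vertexSet xs

  vertexSet⁺ : ∀ {x xs} → x ∈ₗ xs → x ∈ vertexSet xs
  vertexSet⁺ (here refl) = x∈p∪q⁺ (inj₁ (x∈⁅x⁆ _))
  vertexSet⁺ (there x∈) = x∈p∪q⁺ (inj₂ (vertexSet⁺ x∈))

  vertexSet⁻ : ∀ {x} xs → x ∈ vertexSet xs → x ∈ₗ xs
  vertexSet⁻ [] x∈ = ⊥-elim (∉⊥ x∈)
  vertexSet⁻ (y ∷ xs) x∈ with x∈p∪q⁻ ⁅ y ⁆ (vertexSet xs) x∈
  ... | inj₁ x∈⁅y⁆ = here (x∈⁅y⁆⇒x≡y y x∈⁅y⁆)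
  ... | inj₂ x∈xs = there (vertexSet⁻ xs x∈xs)

  inducedRow : EdgeSet n → Subset n → Fin n → Subset n
  inducedRow F S x with lookup S x
  ... | inside = lookup F x ∩ S
  ... | outside = ∅

  induced : EdgeSet n → Subset n → EdgeSet n
  induced F S = tabulate (inducedRow F S)

  induced⁻ : ∀ F S {x y} → x ⇒ y ∈ₑ induced F S → (x ∈ S) × (y ∈ S) × (x ⇒ y ∈ₑ F)
  induced⁻ F S {x} {y} e = fromRow (subst (y ∈_) (Vec.lookup∘tabulate (inducedRow F S) x) e)
    where
      fromRow : y ∈ inducedRow F S x → (x ∈ S) × (y ∈ S) × (x ⇒ y ∈ₑ F)
      fromRow y∈ with lookup S x in x∈S
      ... | inside = Vec.lookup⇒[]= x S x∈S , proj₂ (x∈p∩q⁻ _ _ y∈) , proj₁ (x∈p∩q⁻ _ _ y∈)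
      ... | outside = ⊥-elim (∉⊥ y∈)

  induced⁺ : ∀ F S {x y} → x ∈ S → y ∈ S → x ⇒ y ∈ₑ F → x ⇒ y ∈ₑ induced F S
  induced⁺ F S {x} {y} x∈S y∈S e =
    subst (y ∈_) (sym (Vec.lookup∘tabulate (inducedRow F S) x)) (toRow (Vec.[]=⇒lookup x∈S))
    where
      toRow : lookup S x ≡ inside → y ∈ inducedRow F S x
      toRow x∈ with lookup S x
      toRow refl | .inside = x∈p∩q⁺ (e , y∈S)

  spannedBy : EdgeSet n → List (Fin n) → Graph {n}
  spannedBy F xs = mkGraph (vertexSet xs) (induced F (vertexSet xs))

  spannedBy-subgraph : ∀ F xs → IsSubgraph (spannedBy F xs) (spanning F)
  spannedBy-subgraph F xs =
    (λ _ → ∈⊤) , (λ e → proj₂ (proj₂ (induced⁻ F S e))) ,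
    (λ e → proj₁ (induced⁻ F S e) , proj₁ (proj₂ (induced⁻ F S e)))
    where S = vertexSet xs

  -- Strong connectivity: every vertex reaches c
  -- along the path, c reaches a, and a reaches every vertex.  No articulation point:
  -- after deleting v, every remaining vertex still reaches one of the two ends of the
  -- path, and the ends are joined by the closing edge.
  module Cycle {F : EdgeSet n} {a c : Fin n} {xs : List (Fin n)}
               (path : Path F a c xs) (uniq : Unique xs) (close : c ⇒ a ∈ₑ F ⊎ c ≡ a) where

    Z = spannedBy F xs

    inZ : ∀ {z} → z ∈ₗ xs → z ∈ verts Z
    inZ = vertexSet⁺

    edgeZ : ∀ {x y} → x ∈ₗ xs → y ∈ₗ xs → x ⇒ y ∈ₑ F → x ⇒ y ∈ₑ edges Z
    edgeZ x∈ y∈ = induced⁺ F (vertexSet xs) (inZ x∈) (inZ y∈)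

    Within : List (Fin n) → Set
    Within ys = ∀ {z} → z ∈ₗ ys → z ∈ₗ xs

    toEnd : ∀ {b d ys z} → Path F b d ys → Within ys → z ∈ₗ ys → Walk Z z d
    toEnd [ b ] ⊆xs (here refl) = here (inZ (⊆xs (here refl)))
    toEnd (e ∷ p) ⊆xs (here refl) =
      step (inZ (⊆xs (here refl))) (edgeZ (⊆xs (here refl)) (⊆xs (there (first∈ p))) e)
           (toEnd p (λ z∈ → ⊆xs (there z∈)) (first∈ p))
    toEnd (e ∷ p) ⊆xs (there z∈) = toEnd p (λ z∈' → ⊆xs (there z∈')) z∈

    fromStart : ∀ {b d ys z} → Path F b d ys → Within ys → z ∈ₗ ys → Walk Z b z
    fromStart [ b ] ⊆xs (here refl) = here (inZ (⊆xs (here refl)))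
    fromStart (e ∷ p) ⊆xs (here refl) = here (inZ (⊆xs (here refl)))
    fromStart (e ∷ p) ⊆xs (there z∈) =
      step (inZ (⊆xs (here refl))) (edgeZ (⊆xs (here refl)) (⊆xs (there (first∈ p))) e)
           (fromStart p (λ z∈' → ⊆xs (there z∈')) z∈)

    closing : Walk Z c a
    closing = along close
      where
        along : c ⇒ a ∈ₑ F ⊎ c ≡ a → Walk Z c a
        along (inj₁ e) = step (inZ (last∈ path)) (edgeZ (last∈ path) (first∈ path) e) (here (inZ (first∈ path)))
        along (inj₂ c≡a) = subst (Walk Z c) c≡a (here (inZ (last∈ path)))

    stronglyConnected : StronglyConnected Z
    stronglyConnected x y x∈ y∈ =
      toEnd path (λ z∈ → z∈) (vertexSet⁻ xs x∈) ++ʷ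
      (closing ++ʷ fromStart path (λ z∈ → z∈) (vertexSet⁻ xs y∈))

    module Avoiding (v : Fin n) where
      Kept : Fin n → Set
      Kept z = z ∈ verts Z × z ≢ v

      toEndAvoiding : ∀ {b d ys z} → Path F b d ys → Within ys → v ∉ₗ ys → z ∈ₗ ys →
                      UWalk Z Kept z d
      toEndAvoiding [ b ] ⊆xs v∉ (here refl) = here (inZ (⊆xs (here refl)) , λ b≡v → v∉ (here (sym b≡v)))
      toEndAvoiding (e ∷ p) ⊆xs v∉ (here refl) =
        step (inZ (⊆xs (here refl)) , λ b≡v → v∉ (here (sym b≡v)))
             (inj₁ (edgeZ (⊆xs (here refl)) (⊆xs (there (first∈ p))) e))
             (toEndAvoiding p (λ z∈ → ⊆xs (there z∈)) (λ v∈ → v∉ (there v∈)) (first∈ p))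
      toEndAvoiding (e ∷ p) ⊆xs v∉ (there z∈) =
        toEndAvoiding p (λ z∈' → ⊆xs (there z∈')) (λ v∈ → v∉ (there v∈)) z∈

      -- On a simple sub-path, every vertex other than v reaches one of its two ends
      -- avoiding v: walk backwards until v is met, then forwards instead.
      toAnEnd : ∀ {b d ys z} → Path F b d ys → Within ys → Unique ys → z ∈ₗ ys → z ≢ v →
                UWalk Z Kept z b ⊎ UWalk Z Kept z d
      toAnEnd [ b ] ⊆xs _ (here refl) z≢v = inj₁ (here (inZ (⊆xs (here refl)) , z≢v))
      toAnEnd (e ∷ p) ⊆xs _ (here refl) z≢v = inj₁ (here (inZ (⊆xs (here refl)) , z≢v))
      toAnEnd {b} (e ∷ p) ⊆xs (b∉ ∷ uniq') (there z∈) z≢v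
        with toAnEnd p (λ z∈' → ⊆xs (there z∈')) uniq' z∈ z≢v
      ... | inj₂ toD = inj₂ toD
      ... | inj₁ toNext with b Fin.≟ v
      ...   | no b≢v = inj₁ (toNext ++ᵘ step (end toNext)
                              (inj₂ (edgeZ (⊆xs (here refl)) (⊆xs (there (first∈ p))) e))
                              (here (inZ (⊆xs (here refl)) , b≢v)))
      ...   | yes refl = inj₂ (toEndAvoiding p (λ z∈' → ⊆xs (there z∈'))
                                 (Unique[x∷xs]⇒x∉xs (b∉ ∷ uniq')) z∈)

      endsLinked : Kept a → Kept c → UWalk Z Kept a c
      endsLinked ka kc = along close
        where
          along : c ⇒ a ∈ₑ F ⊎ c ≡ a → UWalk Z Kept a c
          along (inj₁ e) = step ka (inj₂ (edgeZ (last∈ path) (first∈ path) e)) (here kc)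
          along (inj₂ c≡a) = subst (UWalk Z Kept a) (sym c≡a) (here ka)

      viaEnds : ∀ {x y} → UWalk Z Kept x a ⊎ UWalk Z Kept x c →
                UWalk Z Kept y a ⊎ UWalk Z Kept y c → UWalk Z Kept x y
      viaEnds (inj₁ xa) (inj₁ ya) = xa ++ᵘ reverseᵘ ya
      viaEnds (inj₂ xc) (inj₂ yc) = xc ++ᵘ reverseᵘ yc
      viaEnds (inj₁ xa) (inj₂ yc) = xa ++ᵘ (endsLinked (end xa) (end yc) ++ᵘ reverseᵘ yc)
      viaEnds (inj₂ xc) (inj₁ ya) = xc ++ᵘ (reverseᵘ (endsLinked (end ya) (end xc)) ++ᵘ reverseᵘ ya)

    noArticulationPoint : ∀ v → ¬ ArticulationPoint Z v
    noArticulationPoint v (_ , x , y , x∈ , y∈ , x≢v , y≢v , noWalk) =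
      noWalk (viaEnds (toAnEnd path (λ z∈ → z∈) uniq (vertexSet⁻ xs x∈) x≢v)
                      (toAnEnd path (λ z∈ → z∈) uniq (vertexSet⁻ xs y∈) y≢v))
      where open Avoiding v

    stronglyBiconnected : StronglyBiconnected Z
    stronglyBiconnected =
      stronglyConnected , (a , inZ (first∈ path)) ,
      strong⇒connected {Z} stronglyConnected , noArticulationPoint

  -- All vertices pass through a; deleting
  -- a vertex v leaves a common vertex (a or b) through which both sides stay connected.

  _∪ᵍ_ : Graph {n} → Graph {n} → Graph {n}
  A ∪ᵍ B = mkGraph (verts A ∪ verts B) (zipWith _∪_ (edges A) (edges B))

  ∪ᵍ-edge⁻ : ∀ (A B : Graph {n}) {x y} → x ⇒ y ∈ₑ edges (A ∪ᵍ B) →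
             x ⇒ y ∈ₑ edges A ⊎ x ⇒ y ∈ₑ edges B
  ∪ᵍ-edge⁻ A B {x} {y} e = x∈p∪q⁻ _ _ (subst (y ∈_) (Vec.lookup-zipWith _∪_ x (edges A) (edges B)) e)

  ∪ᵍ-edge⁺ : ∀ (A B : Graph {n}) {x y} → x ⇒ y ∈ₑ edges A ⊎ x ⇒ y ∈ₑ edges B →
             x ⇒ y ∈ₑ edges (A ∪ᵍ B)
  ∪ᵍ-edge⁺ A B {x} {y} e = subst (y ∈_) (sym (Vec.lookup-zipWith _∪_ x (edges A) (edges B))) (x∈p∪q⁺ e)

  ∪ᵍ-subgraphˡ : ∀ (A B : Graph {n}) → EdgesInside A → IsSubgraph A (A ∪ᵍ B)
  ∪ᵍ-subgraphˡ A B ends = (λ x∈ → x∈p∪q⁺ (inj₁ x∈)) , (λ e → ∪ᵍ-edge⁺ A B (inj₁ e)) , ends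

  ∪ᵍ-subgraphʳ : ∀ (A B : Graph {n}) → EdgesInside B → IsSubgraph B (A ∪ᵍ B)
  ∪ᵍ-subgraphʳ A B ends = (λ x∈ → x∈p∪q⁺ (inj₂ x∈)) , (λ e → ∪ᵍ-edge⁺ A B (inj₂ e)) , ends

  ∪ᵍ-least : ∀ {A B G : Graph {n}} → IsSubgraph A G → IsSubgraph B G → IsSubgraph (A ∪ᵍ B) G
  ∪ᵍ-least {A} {B} (vA , eA , inA) (vB , eB , inB) =
    (λ x∈ → [ vA , vB ]′ (x∈p∪q⁻ _ _ x∈)) ,
    (λ e → [ eA , eB ]′ (∪ᵍ-edge⁻ A B e)) ,
    (λ e → [ (λ eᴬ → x∈p∪q⁺ (inj₁ (proj₁ (inA eᴬ))) , x∈p∪q⁺ (inj₁ (proj₂ (inA eᴬ))))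
           , (λ eᴮ → x∈p∪q⁺ (inj₂ (proj₁ (inB eᴮ))) , x∈p∪q⁺ (inj₂ (proj₂ (inB eᴮ)))) ]′
           (∪ᵍ-edge⁻ A B e))

  module Union (A B : Graph {n}) (sbA : StronglyBiconnected A) (sbB : StronglyBiconnected B)
               {a b : Fin n} (a∈A : a ∈ verts A) (a∈B : a ∈ verts B)
               (b∈A : b ∈ verts A) (b∈B : b ∈ verts B) (a≢b : a ≢ b) where

    U = A ∪ᵍ B

    fromA : ∀ {x y} → Walk A x y → Walk U x y
    fromA = mapʷ (λ x∈ → x∈p∪q⁺ (inj₁ x∈)) (λ e → ∪ᵍ-edge⁺ A B (inj₁ e))

    fromB : ∀ {x y} → Walk B x y → Walk U x y
    fromB = mapʷ (λ x∈ → x∈p∪q⁺ (inj₂ x∈)) (λ e → ∪ᵍ-edge⁺ A B (inj₂ e))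

    toHub : ∀ {x} → x ∈ verts U → Walk U x a
    toHub {x} x∈ with x∈p∪q⁻ (verts A) (verts B) x∈
    ... | inj₁ x∈A = fromA (proj₁ sbA x a x∈A a∈A)
    ... | inj₂ x∈B = fromB (proj₁ sbB x a x∈B a∈B)

    fromHub : ∀ {x} → x ∈ verts U → Walk U a x
    fromHub {x} x∈ with x∈p∪q⁻ (verts A) (verts B) x∈
    ... | inj₁ x∈A = fromA (proj₁ sbA a x a∈A x∈A)
    ... | inj₂ x∈B = fromB (proj₁ sbB a x a∈B x∈B)

    stronglyConnected : StronglyConnected U
    stronglyConnected x y x∈ y∈ = toHub x∈ ++ʷ fromHub y∈

    module Avoiding (v : Fin n) where
      Kept : Fin n → Set
      Kept z = z ∈ verts U × z ≢ v

      toCommon : ∀ {x} h → h ∈ verts A → h ∈ verts B → h ≢ v → x ∈ verts U → x ≢ v →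
                 ¬ ¬ UWalk U Kept x h
      toCommon {x} h h∈A h∈B h≢v x∈ x≢v with x∈p∪q⁻ (verts A) (verts B) x∈
      ... | inj₁ x∈A = do
        walk ← avoidVertex sbA v x∈A h∈A x≢v h≢v
        pure (mapᵘ (λ (z∈ , z≢v) → x∈p∪q⁺ (inj₁ z∈) , z≢v) (λ e → ∪ᵍ-edge⁺ A B (inj₁ e)) walk)
      ... | inj₂ x∈B = do
        walk ← avoidVertex sbB v x∈B h∈B x≢v h≢v
        pure (mapᵘ (λ (z∈ , z≢v) → x∈p∪q⁺ (inj₂ z∈) , z≢v) (λ e → ∪ᵍ-edge⁺ A B (inj₂ e)) walk)

      viaCommon : ∀ {x y} h → h ∈ verts A → h ∈ verts B → h ≢ v →
                  x ∈ verts U → y ∈ verts U → x ≢ v → y ≢ v → ¬ ¬ UWalk U Kept x y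
      viaCommon h h∈A h∈B h≢v x∈ y∈ x≢v y≢v = do
        xh ← toCommon h h∈A h∈B h≢v x∈ x≢v
        yh ← toCommon h h∈A h∈B h≢v y∈ y≢v
        pure (xh ++ᵘ reverseᵘ yh)

    survivingCommon : ∀ v → Σ (Fin n) λ h → h ∈ verts A × h ∈ verts B × h ≢ v
    survivingCommon v with a Fin.≟ v
    ... | no a≢v = a , a∈A , a∈B , a≢v
    ... | yes refl = b , b∈A , b∈B , a≢b ∘ sym

    noArticulationPoint : ∀ v → ¬ ArticulationPoint U v
    noArticulationPoint v (_ , x , y , x∈ , y∈ , x≢v , y≢v , noWalk) =
      let (h , h∈A , h∈B , h≢v) = survivingCommon v
      in Avoiding.viaCommon v h h∈A h∈B h≢v x∈ y∈ x≢v y≢v noWalk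

    stronglyBiconnected : StronglyBiconnected U
    stronglyBiconnected =
      stronglyConnected , (a , x∈p∪q⁺ (inj₁ a∈A)) ,
      strong⇒connected {U} stronglyConnected , noArticulationPoint

  -- Grow S while a strictly larger strongly biconnected subgraph exists;
  -- this stops since the size (vertices plus edges) is bounded by n + n * n, and a
  -- subgraph of at least the same size is equal to its supergraph.

  edgeCount : ∀ {m} → Vec (Subset n) m → ℕ
  edgeCount [] = 0
  edgeCount (row ∷ F) = ∣ row ∣ + edgeCount F

  size : Graph {n} → ℕ
  size H = ∣ verts H ∣ + edgeCount (edges H)

  _⊆ʳ_ : ∀ {m} → Vec (Subset n) m → Vec (Subset n) m → Set
  F ⊆ʳ F' = ∀ i → lookup F i ⊆ lookup F' i

  edgeCount-mono : ∀ {m} (F F' : Vec (Subset n) m) → F ⊆ʳ F' → edgeCount F ≤ edgeCount F'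
  edgeCount-mono [] [] _ = z≤n
  edgeCount-mono (r ∷ F) (r' ∷ F') sub =
    ℕ.+-mono-≤ (p⊆q⇒∣p∣≤∣q∣ (sub Fin.zero)) (edgeCount-mono F F' (λ i → sub (Fin.suc i)))

  edgeCount-bound : ∀ {m} (F : Vec (Subset n) m) → edgeCount F ≤ m * n
  edgeCount-bound [] = z≤n
  edgeCount-bound (r ∷ F) = ℕ.+-mono-≤ (∣p∣≤n r) (edgeCount-bound F)

  size-bound : ∀ (H : Graph {n}) → size H ≤ n + n * n
  size-bound H = ℕ.+-mono-≤ (∣p∣≤n (verts H)) (edgeCount-bound (edges H))

  +-squeeze : ∀ {a a' b b'} → a ≤ a' → b ≤ b' → a' + b' ≤ a + b → (a' ≤ a) × (b' ≤ b)
  +-squeeze {a} {a'} {b} {b'} a≤a' b≤b' sum≤ =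
    ℕ.+-cancelʳ-≤ b' a' a (ℕ.≤-trans sum≤ (ℕ.+-monoʳ-≤ a b≤b')) ,
    ℕ.+-cancelˡ-≤ a' b' b (ℕ.≤-trans sum≤ (ℕ.+-monoˡ-≤ b a≤a'))

  ⊆-card-eq : ∀ {p q : Subset n} → p ⊆ q → ∣ q ∣ ≤ ∣ p ∣ → p ≡ q
  ⊆-card-eq {p} {q} p⊆q q≤p = ⊆-antisym p⊆q q⊆p
    where
      q⊆p : q ⊆ p
      q⊆p {x} x∈q with x ∈? p
      ... | yes x∈p = x∈p
      ... | no x∉p = ⊥-elim (ℕ.<⇒≱ (p⊂q⇒∣p∣<∣q∣ (p⊆q , x , x∈q , x∉p)) q≤p)

  ⊆ʳ-count-eq : ∀ {m} (F F' : Vec (Subset n) m) → F ⊆ʳ F' → edgeCount F' ≤ edgeCount F → F ≡ F'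
  ⊆ʳ-count-eq [] [] _ _ = refl
  ⊆ʳ-count-eq (r ∷ F) (r' ∷ F') sub count≤
    with +-squeeze (p⊆q⇒∣p∣≤∣q∣ (sub Fin.zero)) (edgeCount-mono F F' (λ i → sub (Fin.suc i))) count≤
  ... | r'≤r , F'≤F = cong₂ _∷_ (⊆-card-eq (sub Fin.zero) r'≤r)
                                (⊆ʳ-count-eq F F' (λ i → sub (Fin.suc i)) F'≤F)

  subgraph-size-eq : ∀ {S H : Graph {n}} → IsSubgraph S H → size H ≤ size S → H ≡ S
  subgraph-size-eq {S} {H} (vs , es , _) size≤
    with +-squeeze (p⊆q⇒∣p∣≤∣q∣ vs) (edgeCount-mono (edges S) (edges H) (λ _ → es)) size≤
  ... | V≤ , E≤ = sym (cong₂ mkGraph (⊆-card-eq vs V≤) (⊆ʳ-count-eq (edges S) (edges H) (λ _ → es) E≤))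

  -- Growing a graph from size s to size s' > s consumes one unit of fuel.
  fuel-transfer : ∀ {B s s' k} → B ≤ s + suc k → s < s' → B ≤ s' + k
  fuel-transfer {B} {s} {s'} {k} bound s<s' =
    ℕ.≤-trans bound (subst (_≤ s' + k) (sym (ℕ.+-suc s k)) (ℕ.+-monoˡ-≤ k s<s'))

  module Maximal (G : Graph {n}) where

    SBCAbove : Graph {n} → Set
    SBCAbove S = Σ (Graph {n}) λ C → IsSBC G C × IsSubgraph S C

    Growth : Graph {n} → Set
    Growth S = Σ (Graph {n}) λ H → IsSubgraph H G × StronglyBiconnected H ×
                                   IsSubgraph S H × size S < size H

    stuck⇒SBC : ∀ {S} → IsSubgraph S G → StronglyBiconnected S → ¬ Growth S → IsSBC G S
    stuck⇒SBC {S} sub sb stuck = sub , sb , maximal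
      where
        maximal : ∀ H → IsSubgraph H G → StronglyBiconnected H → IsSubgraph S H → H ≡ S
        maximal H subH sbH S⊆H with size H ℕ.≤? size S
        ... | yes H≤S = subgraph-size-eq S⊆H H≤S
        ... | no H≰S = ⊥-elim (stuck (H , subH , sbH , S⊆H , ℕ.≰⇒> H≰S))

    -- Growing with fuel k, where the size of S plus k bounds the size of any subgraph.
    grow : ∀ k S → n + n * n ≤ size S + k → IsSubgraph S G → StronglyBiconnected S →
           ¬ ¬ SBCAbove S
    grow zero S bound sub sb = pure (S , stuck⇒SBC sub sb noGrowth , subgraph-refl {S} (proj₂ (proj₂ sub)))
      where
        noGrowth : ¬ Growth S
        noGrowth (H , _ , _ , _ , S<H) = ℕ.<⇒≱ S<H
          (ℕ.≤-trans (size-bound H) (subst (n + n * n ≤_) (ℕ.+-identityʳ (size S)) bound))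
    grow (suc k) S bound sub sb = ¬¬-excluded-middle >>= λ where
      (no stuck) → pure (S , stuck⇒SBC sub sb stuck , subgraph-refl {S} (proj₂ (proj₂ sub)))
      (yes (H , subH , sbH , S⊆H , S<H)) → do
        (C , isC , H⊆C) ← grow k H (fuel-transfer bound S<H) subH sbH
        pure (C , isC , subgraph-trans {S} {H} {C} S⊆H H⊆C)

    extendToSBC : ∀ S → IsSubgraph S G → StronglyBiconnected S → ¬ ¬ SBCAbove S
    extendToSBC S = grow (n + n * n) S (ℕ.m≤n+m (n + n * n) (size S))

pathView : ∀ {n} {F : EdgeSet n} {a c xs} → Path F a c xs →
           (a ≡ c) ⊎ Σ (Fin n) λ b → Σ (List (Fin n)) λ ys →
                       a ⇒ b ∈ₑ F × Path F b c ys × xs ≡ a ∷ ys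
pathView [ a ] = inj₁ refl
pathView (e ∷ p) = inj₂ (_ , _ , e , p , refl)

module Merge {n : ℕ} (Es : EdgeSet n) (u w : Fin n)
  (scS : StronglyConnected (spanning Es))
  (new : ¬ (u ⇒ w ∈ₑ Es))
  (separated : ¬ (∃ λ H → IsSBC (spanning Es) H × u ∈ verts H × w ∈ verts H))
  (L : List (Graph {n})) (isL : ∀ H → (H ∈ₗ L) ⇔ IsSBC (spanning Es) H)
  (L' : List (Graph {n})) (uniqL' : Unique L')
  (isL' : ∀ H → (H ∈ₗ L') ⇔ IsSBC (spanning (addEdge Es u w)) H) where
  open Equivalence

  Gs = spanning Es
  Es' = addEdge Es u w
  Gs' = spanning Es'

  old⇒new-subgraph : ∀ {H} → IsSubgraph H Gs → IsSubgraph H Gs'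
  old⇒new-subgraph (_ , es , ends) = (λ _ → ∈⊤) , (λ e → addEdge⁺ Es u w (es e)) , ends

  CommonSBC : Fin n → Fin n → Set
  CommonSBC a b = Σ (Graph {n}) λ C → C ∈ₗ L × a ∈ verts C × b ∈ verts C

  -- The ends of a simple path closed into a cycle lie in a common SBC; in particular
  -- the ends of every edge do (strong connectivity closes it), and so does every vertex.
  cycle⇒commonSBC : ∀ {a b ys} → Path Es b a ys → Unique ys → a ⇒ b ∈ₑ Es ⊎ a ≡ b →
                    ¬ ¬ CommonSBC a b
  cycle⇒commonSBC {ys = ys} p uniq close = do
    (C , isC , (vs , _)) ← Maximal.extendToSBC Gs (spannedBy Es ys)
                             (spannedBy-subgraph Es ys) (Cycle.stronglyBiconnected p uniq close)
    pure (C , from (isL C) isC , vs (vertexSet⁺ (last∈ p)) , vs (vertexSet⁺ (first∈ p)))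

  edge⇒commonSBC : ∀ {a b} → a ⇒ b ∈ₑ Es → ¬ ¬ CommonSBC a b
  edge⇒commonSBC {a} {b} e with simplePath {F = Es} (scS b a ∈⊤ ∈⊤)
  ... | _ , p , uniq = cycle⇒commonSBC p uniq (inj₁ e)

  vertex⇒commonSBC : ∀ a → ¬ ¬ CommonSBC a a
  vertex⇒commonSBC a = cycle⇒commonSBC [ a ] ([] ∷ []) (inj₂ refl)

  avoiding⇒old : ∀ H → H ∈ₗ L' → ¬ (u ∈ verts H × w ∈ verts H) → H ∈ₗ L
  avoiding⇒old H H∈L' not-uw with to (isL' H) H∈L'
  ... | (_ , es , ends) , sb , maximal' =
    from (isL H) (((λ _ → ∈⊤) , oldEdge , ends) , sb ,
                  λ H' sub' → maximal' H' (old⇒new-subgraph {H'} sub'))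
    where
      oldEdge : edges H ⊆ₑ Es
      oldEdge e with addEdge⁻ Es u w (es e)
      ... | inj₁ e-old = e-old
      ... | inj₂ (refl , refl) = ⊥-elim (not-uw (ends e))

  -- Two SBCs of Gs' sharing two distinct vertices coincide, since their union is
  -- strongly biconnected and contains both.
  sharing⇒equal : ∀ {a b} → a ≢ b → ∀ H M → IsSBC Gs' H → IsSBC Gs' M →
                  a ∈ verts H → b ∈ verts H → a ∈ verts M → b ∈ verts M → H ≡ M
  sharing⇒equal a≢b H M (subH , sbH , maxH) (subM , sbM , maxM) aH bH aM bM =
    trans (sym (maxH K subK sbK (∪ᵍ-subgraphˡ H M (proj₂ (proj₂ subH)))))
          (maxM K subK sbK (∪ᵍ-subgraphʳ H M (proj₂ (proj₂ subM))))
    where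
      K = H ∪ᵍ M
      subK = ∪ᵍ-least {A = H} {B = M} {G = Gs'} subH subM
      sbK = Union.stronglyBiconnected H M sbH sbM aH aM bH bM a≢b

  -- Hence all SBCs of Gs' except at most one (the one through u and w) are SBCs of Gs.
  almostAllOld : u ≢ w → Σ (Graph {n}) λ M → ∀ {H} → H ∈ₗ L' → H ∈ₗ M ∷ L
  almostAllOld u≢w with any? (λ H → (u ∈? verts H) ×-dec (w ∈? verts H)) L'
  ... | no none = Gs , λ {H} H∈L' → there (avoiding⇒old H H∈L' (λ uw → none (lose H∈L' uw)))
  ... | yes some with find some
  ...   | M , M∈L' , uM , wM = M , classify
    where
      classify : ∀ {H} → H ∈ₗ L' → H ∈ₗ M ∷ L
      classify {H} H∈L' with (u ∈? verts H) ×-dec (w ∈? verts H)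
      ... | yes (uH , wH) = here (sharing⇒equal u≢w H M (to (isL' H) H∈L') (to (isL' M) M∈L') uH wH uM wM)
      ... | no not-uw = there (avoiding⇒old H H∈L' not-uw)

  -- An SBC C of Gs sharing two distinct vertices with a strongly biconnected subgraph Z
  -- of Gs' through the new edge is not an SBC of Gs': by maximality C ∪ Z would be C,
  -- which would then contain the new edge.
  absorbed : ∀ {C a b} (Z : Graph {n}) → C ∈ₗ L → IsSubgraph Z Gs' → StronglyBiconnected Z →
             u ⇒ w ∈ₑ edges Z → a ≢ b → a ∈ verts C → b ∈ verts C → a ∈ verts Z → b ∈ verts Z →
             C ∉ₗ L'
  absorbed {C} Z C∈L subZ sbZ uwZ a≢b aC bC aZ bZ C∈L' with to (isL C) C∈L | to (isL' C) C∈L'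
  ... | subC@(_ , esC , endsC) , sbC , _ | _ , _ , maxC =
    new (esC (subst (λ G → u ⇒ w ∈ₑ edges G) K≡C (∪ᵍ-edge⁺ C Z (inj₂ uwZ))))
    where
      K = C ∪ᵍ Z
      K≡C : K ≡ C
      K≡C = maxC K (∪ᵍ-least {A = C} {B = Z} {G = Gs'} (old⇒new-subgraph {C} subC) subZ)
                 (Union.stronglyBiconnected C Z sbC sbZ aC aZ bC bZ a≢b) (∪ᵍ-subgraphˡ C Z endsC)

  apart : ∀ {C₁ C₂} → C₁ ∈ₗ L → w ∈ verts C₁ → u ∈ verts C₂ → C₁ ≢ C₂
  apart {C₁} C₁∈L wC₁ uC₂ refl = separated (C₁ , to (isL C₁) C₁∈L , uC₂ , wC₁)

  twoAbsorbed⇒count : u ≢ w → ∀ {C₁ C₂} → C₁ ∈ₗ L → C₂ ∈ₗ L → C₁ ≢ C₂ →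
                      C₁ ∉ₗ L' → C₂ ∉ₗ L' → suc (length L') ≤ length L
  twoAbsorbed⇒count u≢w {C₁} {C₂} C₁∈L C₂∈L C₁≢C₂ C₁∉L' C₂∉L' =
    s≤s⁻¹ (unique⊆⇒length≤ uniq include)
    where
      M = proj₁ (almostAllOld u≢w)
      uniq : Unique (C₁ ∷ C₂ ∷ L')
      uniq = (C₁≢C₂ ∷ ¬Any⇒All¬ L' C₁∉L') ∷ (¬Any⇒All¬ L' C₂∉L' ∷ uniqL')
      include : ∀ {H} → H ∈ₗ C₁ ∷ C₂ ∷ L' → H ∈ₗ M ∷ L
      include (here refl) = there C₁∈L
      include (there (here refl)) = there C₂∈L
      include (there (there H∈L')) = proj₂ (almostAllOld u≢w) H∈L'

  -- A simple path w → … → u of Gs closed by the new edge spans a strongly biconnected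
  -- subgraph of Gs' through the new edge, so SBCs of Gs meeting it twice are absorbed.
  absorbedByPath : ∀ {xs C a b} → Path Es w u xs → Unique xs → C ∈ₗ L → a ≢ b →
                   a ∈ verts C → b ∈ verts C → a ∈ₗ xs → b ∈ₗ xs → C ∉ₗ L'
  absorbedByPath {xs} path uniq C∈L a≢b aC bC a∈ b∈ =
    absorbed (spannedBy Es' xs) C∈L (spannedBy-subgraph Es' xs)
      (Cycle.stronglyBiconnected (mapᵖ (addEdge⁺ Es u w) path) uniq (inj₁ (addEdge-new Es u w)))
      (induced⁺ Es' (vertexSet xs) (vertexSet⁺ (last∈ path)) (vertexSet⁺ (first∈ path))
                (addEdge-new Es u w))
      a≢b aC bC (vertexSet⁺ a∈) (vertexSet⁺ b∈)

  -- The theorem in double-negated form.  Take a simple path w → x₁ → … → q → u in Gs;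
  -- the SBCs of its first and last edges are the two absorbed ones.
  fewerComponents : ¬ ¬ (suc (length L') ≤ length L)
  fewerComponents with simplePath {F = Es} (scS w u ∈⊤ ∈⊤)
  ... | xs , path , uniq with pathView path
  ... | inj₁ w≡u = do
    (C , C∈L , uC , _) ← vertex⇒commonSBC u
    ⊥-elim (separated (C , to (isL C) C∈L , uC , subst (_∈ verts C) (sym w≡u) uC))
  ... | inj₂ (x₁ , ys , w⇒x₁ , rest , refl)
    with lastEdge path uniq (unique-head uniq (last∈ rest))
  ... | q , q∈ , q⇒u , q≢u = do
    (C₁ , C₁∈L , wC₁ , x₁C₁) ← edge⇒commonSBC w⇒x₁
    (C₂ , C₂∈L , qC₂ , uC₂) ← edge⇒commonSBC q⇒u
    let u≢w = unique-head uniq (last∈ rest) ∘ sym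
        w≢x₁ = unique-head uniq (first∈ rest)
        C₁∉L' = absorbedByPath path uniq C₁∈L w≢x₁ wC₁ x₁C₁ (here refl) (there (first∈ rest))
        C₂∉L' = absorbedByPath path uniq C₂∈L q≢u qC₂ uC₂ q∈ (last∈ path)
    pure (twoAbsorbed⇒count u≢w C₁∈L C₂∈L (apart C₁∈L wC₁ uC₂) C₁∉L' C₂∉L')

lemma1 : ∀ {n : ℕ} (E Es : EdgeSet n) (t : ℕ) (u w : Fin n) →
    StronglyBiconnected (spanning E) →
    Es ⊆ₑ E →
    StronglyConnected (spanning Es) →
    NumSBC (spanning Es) t → 0 < t →
    u ⇒ w ∈ₑ E → ¬ (u ⇒ w ∈ₑ Es) →
    ¬ (∃ λ H → IsSBC (spanning Es) H × u ∈ verts H × w ∈ verts H) →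
    ∀ t' → NumSBC (spanning (addEdge Es u w)) t' → t' ≤ t ∸ 1
lemma1 E Es t u w _ _ scS (L , _ , isL , refl) _ _ new separated t' (L' , uniqL' , isL' , refl) =
  decidable-stable (length L' ℕ.≤? length L ∸ 1) (do
    fewer ← Merge.fewerComponents Es u w scS new separated L isL L' uniqL' isL'
    pure (ℕ.∸-monoˡ-≤ 1 fewer))
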